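{- Let $J_1$ be the graph with vertex set $\{v_1,v_2,v_3,v_4,v_5\}$ and edge set $\{v_1v_2, v_2v_3, v_3v_4, v_2v_5, v_3v_5\}$, and let $L$ be a list assignment on $V(J_1)$ with $|L(v_1)|=2$, $|L(v_2)|=3$, $|L(v_3)|=4$, $|L(v_4)|=3$, and $|L(v_5)|=3$. Then $J_1^2$ is $L$-colorable.
   Context: The square $H^2$ of a graph $H$ has vertex set $V(H)$ and an edge between any two distinct vertices at distance at most $2$ in $H$. For a list assignment $L$ (assigning a set of colors to each vertex), a graph is $L$-colorable if it admits a proper coloring $f$ with $f(v)\in L(v)$ for every vertex $v$. -}

module Defs where

open import Data.Nat using (ℕ)
open import Data.Fin using (Fin; zero; suc)
open import Data.Empty using (⊥)
open import Data.Unit using (⊤)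
open import Data.Sum using (_⊎_)
open import Data.Product using (_×_; ∃; ∃-syntax)
open import Data.List using (List; length)
open import Data.List.Membership.Propositional using (_∈_)
open import Data.List.Relation.Unary.Unique.Propositional using (Unique)
open import Relation.Binary.PropositionalEquality using (_≡_; _≢_)

record Graph (n : ℕ) : Set₁ where
  field
    Adj : Fin n → Fin n → Set
open Graph public

Square : ∀ {n} → Graph n → Graph n
Adj (Square G) u v = u ≢ v × (Adj G u v ⊎ ∃[ w ] (Adj G u w × Adj G w v))

-- Colors are natural numbers; a list assignment gives each vertex a list
-- of colors (its size is measured on duplicate-free lists).
ListAssignment : ℕ → Set
ListAssignment n = Fin n → List ℕ

LColorable : ∀ {n} → Graph n → ListAssignment n → Set
LColorable {n} G L =
  ∃ λ (f : Fin n → ℕ) → ((∀ (v : Fin n) → f v ∈ L v) ×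
          (∀ (u v : Fin n) → Adj G u v → f u ≢ f v))

-- J₁: vertices v₁..v₅ are 0..4; edges v1v2, v2v3, v3v4, v2v5, v3v5.
J₁Edge : Fin 5 → Fin 5 → Set
J₁Edge zero (suc zero) = ⊤
J₁Edge (suc zero) (suc (suc zero)) = ⊤
J₁Edge (suc (suc zero)) (suc (suc (suc zero))) = ⊤
J₁Edge (suc zero) (suc (suc (suc (suc zero)))) = ⊤
J₁Edge (suc (suc zero)) (suc (suc (suc (suc zero)))) = ⊤
J₁Edge _ _ = ⊥

J₁ : Graph 5
Adj J₁ u v = J₁Edge u v ⊎ J₁Edge v u

{-# OPTIONS --safe #-}
-- J₁² is K₅ minus the edge v₁v₄, so a coloring is proper as soon as it is
-- injective apart from the pair v₁, v₄, and each case is finished greedily.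
-- If L(v₁) and L(v₄) share a color c, put c on both and color v₂, v₅, v₃.
-- Otherwise L(v₁) ∪ L(v₄) has five colors and L(v₃) only four.  A color
-- a ∈ L(v₁) ∖ L(v₃) goes on v₁, after which v₃ may ignore v₁.  If L(v₁) ⊆ L(v₃),
-- some y ∈ L(v₄) ∖ L(v₃) goes on v₄ instead, and v₁ takes a color outside
-- L(v₅) if there is one; if L(v₁) ⊆ L(v₅), the two colors of L(v₁) go on v₁
-- and v₅, where disjointness keeps them away from v₄.
module Submission where

open import Defs
open import Data.Nat using (ℕ; _≤_; _<_; _<?_; _+_; z≤n)
import Data.Nat as ℕ
open import Data.Nat.Properties using (<⇒≱; n<1+n; module ≤-Reasoning)
open import Data.Fin using (Fin; zero; suc)
open import Data.List using (List; []; _∷_; _++_; length; filter)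
open import Data.List.Properties using (length-++; filter-notAll)
open import Data.List.Relation.Unary.All using (All; []; _∷_)
import Data.List.Relation.Unary.All as All
open import Data.List.Relation.Unary.All.Properties using (¬Any⇒All¬)
open import Data.List.Relation.Unary.Any using (here; there; any?)
import Data.List.Relation.Unary.Any as Any
open import Data.List.Relation.Unary.AllPairs using ([]; _∷_)
open import Data.List.Relation.Unary.Unique.Propositional using (Unique)
open import Data.List.Relation.Unary.Unique.Propositional.Properties using (++⁺)
open import Data.List.Relation.Binary.Subset.Propositional using (_⊆_)
open import Data.List.Relation.Binary.Disjoint.Propositional using (Disjoint)
open import Data.List.Membership.Propositional using (_∈_; _∉_; find; lose)
open import Data.List.Membership.Propositional.Properties using (∈-filter⁺; ∈-++⁻)
open import Data.Product using (_×_; _,_; ∃-syntax)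
open import Data.Sum using (_⊎_; inj₁; inj₂; swap)
open import Function using (_∘_)
open import Relation.Nullary using (¬_; yes; no; ¬?; contradiction)
open import Relation.Nullary.Decidable using (True; toWitness; decidable-stable)
open import Relation.Unary using (Decidable)
open import Relation.Binary.Definitions using (DecidableEquality; Symmetric)
open import Relation.Binary.PropositionalEquality
  using (_≡_; _≢_; refl; cong₂; ≢-sym)

∈-∉⇒≢ : ∀ {a} {A : Set a} {x y : A} {xs} → x ∈ xs → y ∉ xs → x ≢ y
∈-∉⇒≢ x∈xs y∉xs refl = y∉xs x∈xs

module _ {a} {A : Set a} (_≟_ : DecidableEquality A) where
  open import Data.List.Membership.DecPropositional _≟_ using (_∈?_; _∉?_)

  ⊆-or-∃-∈-∉ : (xs ys : List A) → xs ⊆ ys ⊎ ∃[ x ] (x ∈ xs × x ∉ ys)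
  ⊆-or-∃-∈-∉ xs ys with any? (_∉? ys) xs
  ... | yes some = inj₂ (find some)
  ... | no none  = inj₁ λ x∈xs → decidable-stable (_ ∈? ys) (none ∘ lose x∈xs)

  common-or-Disjoint : (xs ys : List A) → ∃[ x ] (x ∈ xs × x ∈ ys) ⊎ Disjoint xs ys
  common-or-Disjoint xs ys with any? (_∈? ys) xs
  ... | yes some = inj₁ (find some)
  ... | no none  = inj₂ λ (x∈xs , x∈ys) → none (lose x∈xs x∈ys)

  Unique⇒length-mono-⊆ : ∀ {xs ys} → Unique xs → xs ⊆ ys → length xs ≤ length ys
  Unique⇒length-mono-⊆ [] _ = z≤n
  Unique⇒length-mono-⊆ {x ∷ xs} {ys} (x≢xs ∷ xs!) x∷xs⊆ys = begin-strict
    length xs      ≤⟨ Unique⇒length-mono-⊆ xs! xs⊆ys∖x ⟩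
    length ys∖x    <⟨ filter-notAll x≢? ys (Any.map (λ x≡y x≢y → x≢y x≡y) (x∷xs⊆ys (here refl))) ⟩
    length ys      ∎
    where
    open ≤-Reasoning
    x≢? : Decidable (x ≢_)
    x≢? y = ¬? (x ≟ y)
    ys∖x : List A
    ys∖x = filter x≢? ys
    xs⊆ys∖x : xs ⊆ ys∖x
    xs⊆ys∖x z∈xs = ∈-filter⁺ x≢? (x∷xs⊆ys (there z∈xs)) (All.lookup x≢xs z∈xs)

  length<⇒∃-∈-∉ : ∀ {xs} ys → Unique xs → length ys < length xs → ∃[ x ] (x ∈ xs × x ∉ ys)
  length<⇒∃-∈-∉ {xs} ys xs! ys<xs with ⊆-or-∃-∈-∉ xs ys
  ... | inj₁ xs⊆ys   = contradiction (Unique⇒length-mono-⊆ xs! xs⊆ys) (<⇒≱ ys<xs)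
  ... | inj₂ x∈xs∖ys = x∈xs∖ys

  length<⇒∃-∈ʳ-∉ : ∀ {xs zs ys} → Unique (xs ++ zs) → xs ⊆ ys →
                   length ys < length (xs ++ zs) → ∃[ z ] (z ∈ zs × z ∉ ys)
  length<⇒∃-∈ʳ-∉ {xs} {ys = ys} xs++zs! xs⊆ys ys<xs++zs
    with z , z∈xs++zs , z∉ys ← length<⇒∃-∈-∉ ys xs++zs! ys<xs++zs
    with ∈-++⁻ xs z∈xs++zs
  ... | inj₁ z∈xs = contradiction (xs⊆ys z∈xs) z∉ys
  ... | inj₂ z∈zs = z , z∈zs , z∉ys

Square-sym : ∀ {n} {G : Graph n} → Symmetric (Adj G) → Symmetric (Adj (Square G))
Square-sym sym (u≢v , inj₁ u~v)            = ≢-sym u≢v , inj₁ (sym u~v)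
Square-sym sym (u≢v , inj₂ (w , u~w , w~v)) = ≢-sym u≢v , inj₂ (w , sym w~v , sym u~w)

J₁-sym : Symmetric (Adj J₁)
J₁-sym = swap

pattern v₁ = zero
pattern v₂ = suc zero
pattern v₃ = suc (suc zero)
pattern v₄ = suc (suc (suc zero))
pattern v₅ = suc (suc (suc (suc zero)))

v₁≁v₄ : ¬ Adj (Square J₁) v₁ v₄
v₁≁v₄ (_ , inj₁ (inj₁ ()))
v₁≁v₄ (_ , inj₁ (inj₂ ()))
v₁≁v₄ (_ , inj₂ (v₁ , inj₁ () , _))
v₁≁v₄ (_ , inj₂ (v₁ , inj₂ () , _))
v₁≁v₄ (_ , inj₂ (v₂ , _ , inj₁ ()))
v₁≁v₄ (_ , inj₂ (v₂ , _ , inj₂ ()))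
v₁≁v₄ (_ , inj₂ (v₃ , inj₁ () , _))
v₁≁v₄ (_ , inj₂ (v₃ , inj₂ () , _))
v₁≁v₄ (_ , inj₂ (v₄ , inj₁ () , _))
v₁≁v₄ (_ , inj₂ (v₄ , inj₂ () , _))
v₁≁v₄ (_ , inj₂ (v₅ , inj₁ () , _))
v₁≁v₄ (_ , inj₂ (v₅ , inj₂ () , _))

J₁²-coloring : ∀ {L : ListAssignment 5} {c₁ c₂ c₃ c₄ c₅} →
  c₁ ∈ L v₁ → c₂ ∈ L v₂ → c₃ ∈ L v₃ → c₄ ∈ L v₄ → c₅ ∈ L v₅ →
  c₁ ≢ c₂ → c₁ ≢ c₃ → c₁ ≢ c₅ → c₂ ≢ c₃ → c₂ ≢ c₄ → c₂ ≢ c₅ → c₃ ≢ c₄ → c₃ ≢ c₅ → c₄ ≢ c₅ →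
  LColorable (Square J₁) L
J₁²-coloring {L} {c₁} {c₂} {c₃} {c₄} {c₅} c₁∈ c₂∈ c₃∈ c₄∈ c₅∈
  c₁≢c₂ c₁≢c₃ c₁≢c₅ c₂≢c₃ c₂≢c₄ c₂≢c₅ c₃≢c₄ c₃≢c₅ c₄≢c₅ = f , f∈L , proper
  where
  f : Fin 5 → ℕ
  f v₁ = c₁
  f v₂ = c₂
  f v₃ = c₃
  f v₄ = c₄
  f v₅ = c₅
  f∈L : ∀ v → f v ∈ L v
  f∈L v₁ = c₁∈
  f∈L v₂ = c₂∈
  f∈L v₃ = c₃∈
  f∈L v₄ = c₄∈
  f∈L v₅ = c₅∈
  proper : ∀ u v → Adj (Square J₁) u v → f u ≢ f v
  proper v₁ v₁ (v₁≢v₁ , _) = contradiction refl v₁≢v₁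
  proper v₁ v₂ _ = c₁≢c₂
  proper v₁ v₃ _ = c₁≢c₃
  proper v₁ v₄ v₁~v₄ = contradiction v₁~v₄ v₁≁v₄
  proper v₁ v₅ _ = c₁≢c₅
  proper v₂ v₁ _ = ≢-sym c₁≢c₂
  proper v₂ v₂ (v₂≢v₂ , _) = contradiction refl v₂≢v₂
  proper v₂ v₃ _ = c₂≢c₃
  proper v₂ v₄ _ = c₂≢c₄
  proper v₂ v₅ _ = c₂≢c₅
  proper v₃ v₁ _ = ≢-sym c₁≢c₃
  proper v₃ v₂ _ = ≢-sym c₂≢c₃
  proper v₃ v₃ (v₃≢v₃ , _) = contradiction refl v₃≢v₃
  proper v₃ v₄ _ = c₃≢c₄
  proper v₃ v₅ _ = c₃≢c₅
  proper v₄ v₁ v₄~v₁ = contradiction (Square-sym {G = J₁} J₁-sym v₄~v₁) v₁≁v₄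
  proper v₄ v₂ _ = ≢-sym c₂≢c₄
  proper v₄ v₃ _ = ≢-sym c₃≢c₄
  proper v₄ v₄ (v₄≢v₄ , _) = contradiction refl v₄≢v₄
  proper v₄ v₅ _ = c₄≢c₅
  proper v₅ v₁ _ = ≢-sym c₁≢c₅
  proper v₅ v₂ _ = ≢-sym c₂≢c₅
  proper v₅ v₃ _ = ≢-sym c₃≢c₅
  proper v₅ v₄ _ = ≢-sym c₄≢c₅
  proper v₅ v₅ (v₅≢v₅ , _) = contradiction refl v₅≢v₅

module Greedy (L : ListAssignment 5) (L! : ∀ v → Unique (L v))
  (∣L₁∣ : length (L v₁) ≡ 2) (∣L₂∣ : length (L v₂) ≡ 3) (∣L₃∣ : length (L v₃) ≡ 4)
  (∣L₄∣ : length (L v₄) ≡ 3) (∣L₅∣ : length (L v₅) ≡ 3) where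

  pick-avoiding : ∀ v {k} → length (L v) ≡ k → (ys : List ℕ) → {True (length ys <? k)} →
                  ∃[ x ] (x ∈ L v × All (_≢ x) ys)
  pick-avoiding v refl ys {ys<k}
    with x , x∈L , x∉ys ← length<⇒∃-∈-∉ ℕ._≟_ ys (L! v) (toWitness ys<k)
    = x , x∈L , All.map ≢-sym (¬Any⇒All¬ ys x∉ys)

  ∃-∈L₄-∉L₃ : Disjoint (L v₁) (L v₄) → L v₁ ⊆ L v₃ → ∃[ y ] (y ∈ L v₄ × y ∉ L v₃)
  ∃-∈L₄-∉L₃ L₁#L₄ L₁⊆L₃ =
    length<⇒∃-∈ʳ-∉ ℕ._≟_ (++⁺ (L! v₁) (L! v₄) L₁#L₄) L₁⊆L₃ ∣L₃∣<∣L₁++L₄∣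
    where
    open ≤-Reasoning
    ∣L₃∣<∣L₁++L₄∣ : length (L v₃) < length (L v₁ ++ L v₄)
    ∣L₃∣<∣L₁++L₄∣ = begin-strict
      length (L v₃)                  ≡⟨ ∣L₃∣ ⟩
      4                              <⟨ n<1+n 4 ⟩
      2 + 3                          ≡⟨ cong₂ _+_ ∣L₁∣ ∣L₄∣ ⟨
      length (L v₁) + length (L v₄)  ≡⟨ length-++ (L v₁) ⟨
      length (L v₁ ++ L v₄)          ∎

  color-v₁v₄-alike : ∀ {c} → c ∈ L v₁ → c ∈ L v₄ → LColorable (Square J₁) L
  color-v₁v₄-alike {c} c∈L₁ c∈L₄
    with x₂ , x₂∈L₂ , c≢x₂ ∷ [] ← pick-avoiding v₂ ∣L₂∣ (c ∷ [])
    with x₅ , x₅∈L₅ , c≢x₅ ∷ x₂≢x₅ ∷ [] ← pick-avoiding v₅ ∣L₅∣ (c ∷ x₂ ∷ [])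
    with x₃ , x₃∈L₃ , c≢x₃ ∷ x₂≢x₃ ∷ x₅≢x₃ ∷ [] ← pick-avoiding v₃ ∣L₃∣ (c ∷ x₂ ∷ x₅ ∷ [])
    = J₁²-coloring c∈L₁ x₂∈L₂ x₃∈L₃ c∈L₄ x₅∈L₅
        c≢x₂ c≢x₃ c≢x₅ x₂≢x₃ (≢-sym c≢x₂) x₂≢x₅ (≢-sym c≢x₃) (≢-sym x₅≢x₃) c≢x₅

  color-v₁-outside-L₃ : ∀ {a} → a ∈ L v₁ → a ∉ L v₃ → LColorable (Square J₁) L
  color-v₁-outside-L₃ {a} a∈L₁ a∉L₃
    with x₂ , x₂∈L₂ , a≢x₂ ∷ [] ← pick-avoiding v₂ ∣L₂∣ (a ∷ [])
    with x₅ , x₅∈L₅ , a≢x₅ ∷ x₂≢x₅ ∷ [] ← pick-avoiding v₅ ∣L₅∣ (a ∷ x₂ ∷ [])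
    with x₄ , x₄∈L₄ , x₂≢x₄ ∷ x₅≢x₄ ∷ [] ← pick-avoiding v₄ ∣L₄∣ (x₂ ∷ x₅ ∷ [])
    with x₃ , x₃∈L₃ , x₂≢x₃ ∷ x₄≢x₃ ∷ x₅≢x₃ ∷ [] ← pick-avoiding v₃ ∣L₃∣ (x₂ ∷ x₄ ∷ x₅ ∷ [])
    = J₁²-coloring a∈L₁ x₂∈L₂ x₃∈L₃ x₄∈L₄ x₅∈L₅
        a≢x₂ (≢-sym (∈-∉⇒≢ x₃∈L₃ a∉L₃)) a≢x₅ x₂≢x₃ x₂≢x₄ x₂≢x₅
        (≢-sym x₄≢x₃) (≢-sym x₅≢x₃) (≢-sym x₅≢x₄)

  color-v₁-outside-L₅ : ∀ {a y} → a ∈ L v₁ → a ∉ L v₅ → y ∈ L v₄ → y ∉ L v₃ →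
                         LColorable (Square J₁) L
  color-v₁-outside-L₅ {a} {y} a∈L₁ a∉L₅ y∈L₄ y∉L₃
    with x₂ , x₂∈L₂ , a≢x₂ ∷ y≢x₂ ∷ [] ← pick-avoiding v₂ ∣L₂∣ (a ∷ y ∷ [])
    with x₅ , x₅∈L₅ , y≢x₅ ∷ x₂≢x₅ ∷ [] ← pick-avoiding v₅ ∣L₅∣ (y ∷ x₂ ∷ [])
    with x₃ , x₃∈L₃ , a≢x₃ ∷ x₂≢x₃ ∷ x₅≢x₃ ∷ [] ← pick-avoiding v₃ ∣L₃∣ (a ∷ x₂ ∷ x₅ ∷ [])
    = J₁²-coloring a∈L₁ x₂∈L₂ x₃∈L₃ y∈L₄ x₅∈L₅
        a≢x₂ a≢x₃ (≢-sym (∈-∉⇒≢ x₅∈L₅ a∉L₅)) x₂≢x₃ (≢-sym y≢x₂) x₂≢x₅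
        (∈-∉⇒≢ x₃∈L₃ y∉L₃) (≢-sym x₅≢x₃) y≢x₅

  color-v₁v₅-from-L₁ : Disjoint (L v₁) (L v₄) → L v₁ ⊆ L v₅ → LColorable (Square J₁) L
  color-v₁v₅-from-L₁ L₁#L₄ L₁⊆L₅
    with x₁ , x₁∈L₁ , [] ← pick-avoiding v₁ ∣L₁∣ []
    with x₅ , x₅∈L₁ , x₁≢x₅ ∷ [] ← pick-avoiding v₁ ∣L₁∣ (x₁ ∷ [])
    with x₂ , x₂∈L₂ , x₁≢x₂ ∷ x₅≢x₂ ∷ [] ← pick-avoiding v₂ ∣L₂∣ (x₁ ∷ x₅ ∷ [])
    with x₃ , x₃∈L₃ , x₁≢x₃ ∷ x₂≢x₃ ∷ x₅≢x₃ ∷ [] ← pick-avoiding v₃ ∣L₃∣ (x₁ ∷ x₂ ∷ x₅ ∷ [])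
    with x₄ , x₄∈L₄ , x₂≢x₄ ∷ x₃≢x₄ ∷ [] ← pick-avoiding v₄ ∣L₄∣ (x₂ ∷ x₃ ∷ [])
    = J₁²-coloring x₁∈L₁ x₂∈L₂ x₃∈L₃ x₄∈L₄ (L₁⊆L₅ x₅∈L₁)
        x₁≢x₂ x₁≢x₃ x₁≢x₅ x₂≢x₃ x₂≢x₄ (≢-sym x₅≢x₂) x₃≢x₄ (≢-sym x₅≢x₃)
        (∈-∉⇒≢ x₄∈L₄ (λ x₅∈L₄ → L₁#L₄ (x₅∈L₁ , x₅∈L₄)))

lemma2p2 : (L : ListAssignment 5) → (∀ v → Unique (L v)) →
    length (L zero) ≡ 2 →
    length (L (suc zero)) ≡ 3 →
    length (L (suc (suc zero))) ≡ 4 →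
    length (L (suc (suc (suc zero)))) ≡ 3 →
    length (L (suc (suc (suc (suc zero))))) ≡ 3 →
    LColorable (Square J₁) L
lemma2p2 L L! ∣L₁∣ ∣L₂∣ ∣L₃∣ ∣L₄∣ ∣L₅∣ = color (common-or-Disjoint ℕ._≟_ (L v₁) (L v₄))
  where
  open Greedy L L! ∣L₁∣ ∣L₂∣ ∣L₃∣ ∣L₄∣ ∣L₅∣
  color : ∃[ c ] (c ∈ L v₁ × c ∈ L v₄) ⊎ Disjoint (L v₁) (L v₄) → LColorable (Square J₁) L
  color (inj₁ (c , c∈L₁ , c∈L₄)) = color-v₁v₄-alike c∈L₁ c∈L₄
  color (inj₂ L₁#L₄) with ⊆-or-∃-∈-∉ ℕ._≟_ (L v₁) (L v₃) | ⊆-or-∃-∈-∉ ℕ._≟_ (L v₁) (L v₅)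
  ... | inj₂ (a , a∈L₁ , a∉L₃) | _          = color-v₁-outside-L₃ a∈L₁ a∉L₃
  ... | inj₁ _                 | inj₁ L₁⊆L₅ = color-v₁v₅-from-L₁ L₁#L₄ L₁⊆L₅
  ... | inj₁ L₁⊆L₃             | inj₂ (a , a∈L₁ , a∉L₅)
      with y , y∈L₄ , y∉L₃ ← ∃-∈L₄-∉L₃ L₁#L₄ L₁⊆L₃
      = color-v₁-outside-L₅ a∈L₁ a∉L₅ y∈L₄ y∉L₃
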